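{- For every finite graph $G$ and every integer $k\ge 1$, $i(G\times K_k)\le\max\{a(G),a(K_k)\}$ (and hence $i(G\times K_k)\le \max\{a^*(G),a^*(K_k)\}$). Moreover, the same inequality $i(G\times H)\le\max\{a(G),a(H)\}$ holds when $H$ is a disjoint union of complete graphs.
   Context: Tensor product $G\times H$: vertex set $V(G)\times V(H)$, $(u,v)\sim(u',v')$ iff $uu'\in E(G)$ and $vv'\in E(H)$. $i(G)=\alpha(G)/|V(G)|$. $N(I)$ is the set of vertices with a neighbor in $I$; $a(G)=\max_I \frac{|I|}{|I|+|N(I)|}$ over nonempty independent sets $I$; $a^*(G)=a(G)$ if $a(G)\le\frac12$ and $a^*(G)=1$ otherwise. $K_k$ is the complete graph on $k$ vertices. -}

module Defs where

open import Data.Bool using (Bool; true; false; _∧_; _∨_; not; if_then_else_)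
open import Data.Nat using (ℕ; zero; suc; _+_; _*_; _⊔_)
open import Data.Fin using (Fin; remQuot; _≟_)
open import Data.Fin.Subset using (Subset; ∣_∣; _∈_)
open import Data.Vec using (Vec; []; _∷_; tabulate; lookup)
open import Data.List using (List; []; _∷_; map; foldr; filter; concatMap; allFin)
open import Data.Bool.ListAction using (any)
open import Data.Product using (_×_; _,_; proj₁; proj₂; ∃)
open import Data.Integer using (+_)
open import Data.Rational using (ℚ; 0ℚ; 1ℚ; ½; _/_; _≤_) renaming (_⊔_ to _⊔ℚ_)
open import Relation.Nullary using (¬_; does)
open import Relation.Binary.PropositionalEquality using (_≡_; refl; cong₂; sym)
open import Function using (_⇔_)

record Graph : Set where
  field
    n     : ℕ
    adj   : Fin n → Fin n → Bool
    adj-sym : ∀ u v → adj u v ≡ adj v u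
    adj-irrefl : ∀ u → adj u u ≡ false
open Graph public

V : Graph → Set
V G = Fin (n G)

-- Tensor (categorical) product G × H, vertex set Fin (|G| * |H|)
-- identified with Fin |G| × Fin |H| via remQuot.

private
  ∧-false : ∀ b → (false ∧ b) ≡ false
  ∧-false b = refl

_⊗_ : Graph → Graph → Graph
G ⊗ H = record
  { n = n G * n H
  ; adj = λ x y → adj G (proj₁ (remQuot {n G} (n H) x)) (proj₁ (remQuot {n G} (n H) y))
                ∧ adj H (proj₂ (remQuot {n G} (n H) x)) (proj₂ (remQuot {n G} (n H) y))
  ; adj-sym = λ x y → cong₂ _∧_ (Graph.adj-sym G _ _) (Graph.adj-sym H _ _)
  ; adj-irrefl = λ x → irr x
  }
  where
  irr : ∀ x → (adj G (proj₁ (remQuot {n G} (n H) x)) (proj₁ (remQuot {n G} (n H) x))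
               ∧ adj H (proj₂ (remQuot {n G} (n H) x)) (proj₂ (remQuot {n G} (n H) x))) ≡ false
  irr x rewrite Graph.adj-irrefl G (proj₁ (remQuot {n G} (n H) x)) = refl

K : ℕ → Graph
K k = record
  { n = k
  ; adj = λ u v → not (does (u ≟ v))
  ; adj-sym = λ u v → symK u v
  ; adj-irrefl = λ u → irrK u
  }
  where
  symK : (u v : Fin k) → not (does (u ≟ v)) ≡ not (does (v ≟ u))
  symK u v with u ≟ v | v ≟ u
  ... | Relation.Nullary.yes _ | Relation.Nullary.yes _ = refl
  ... | Relation.Nullary.no _  | Relation.Nullary.no _  = refl
  ... | Relation.Nullary.yes p | Relation.Nullary.no q  = Data.Empty.⊥-elim (q (sym p))
    where import Data.Empty
  ... | Relation.Nullary.no q  | Relation.Nullary.yes p = Data.Empty.⊥-elim (q (sym p))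
    where import Data.Empty
  irrK : (u : Fin k) → not (does (u ≟ u)) ≡ false
  irrK u with u ≟ u
  ... | Relation.Nullary.yes _ = refl
  ... | Relation.Nullary.no q = Data.Empty.⊥-elim (q refl)
    where import Data.Empty

-- H is (isomorphic to) a disjoint union of complete graphs: there is a
-- labelling of the vertices by component such that two vertices are
-- adjacent exactly when they are distinct and lie in the same component.
IsDisjointUnionOfCompletes : Graph → Set
IsDisjointUnionOfCompletes H =
  ∃ λ (c : V H → ℕ) → ∀ u v → (adj H u v ≡ true) ⇔ ((¬ (u ≡ v)) × (c u ≡ c v))

allSubsets : (m : ℕ) → List (Subset m)
allSubsets zero = [] ∷ []
allSubsets (suc m) = concatMap (λ s → (false ∷ s) ∷ (true ∷ s) ∷ []) (allSubsets m)

isIndependent : (G : Graph) → Subset (n G) → Bool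
isIndependent G I =
  not (any (λ u → any (λ v → lookup I u ∧ lookup I v ∧ adj G u v) (allFin (n G))) (allFin (n G)))

nbhd : (G : Graph) → Subset (n G) → Subset (n G)
nbhd G I = tabulate (λ v → any (λ u → lookup I u ∧ adj G u v) (allFin (n G)))

isNonempty : ∀ {m} → Subset m → Bool
isNonempty I = any (lookup I) (allFin _)

-- p / q as a rational, with the convention p / 0 = 0 (never used with
-- q = 0 below except for the empty graph).
frac : ℕ → ℕ → ℚ
frac p zero = 0ℚ
frac p (suc q) = (+ p) / suc q

maxℚ : List ℚ → ℚ
maxℚ = foldr _⊔ℚ_ 0ℚ

maxℕ : List ℕ → ℕ
maxℕ = foldr _⊔_ 0

α : Graph → ℕ
α G = maxℕ (map ∣_∣ (filter (λ I → isIndependent G I Data.Bool.≟ true) (allSubsets (n G))))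
  where import Data.Bool

i : Graph → ℚ
i G = frac (α G) (n G)

-- a(G) = max over nonempty independent I of |I| / (|I| + |N(I)|)
-- (0 if G has no vertices, so there is no nonempty independent set).
a : Graph → ℚ
a G = maxℚ (map (λ I → frac ∣ I ∣ (∣ I ∣ + ∣ nbhd G I ∣))
               (filter (λ I → (isIndependent G I ∧ isNonempty I) Data.Bool.≟ true)
                       (allSubsets (n G))))
  where import Data.Bool

a* : Graph → ℚ
a* G with Data.Rational._≤?_ (a G) ½
  where import Data.Rational
... | Relation.Nullary.yes _ = a G
... | Relation.Nullary.no _ = 1ℚ

-- Let I be independent in G × H, where H is a disjoint union of cliques, and
-- put a = max(a(G), a(H)).  Fix a clique C of H of size k, and for u ∈ V(G) let
-- f(u) be the number of w ∈ C with (u, w) ∈ I.  Since C is a clique, a vertex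
-- with f(u) ≥ 2 has no neighbour u' with f(u') ≥ 1: some w' ≠ w would give
-- adjacent (u, w), (u', w') in I.  So S = {u : f(u) ≥ 2} is independent in G
-- and f vanishes on N(S), whence Σ f ≤ k|S| + (|V(G)| − |S| − |N(S)|).
-- Combined with |S| ≤ a(|S| + |N(S)|) and, from a single vertex of C (whose
-- closed neighbourhood is C), 1 ≤ a k, this gives Σ f ≤ a |V(G)| k.  Summing
-- over the cliques of H yields |I| ≤ a |V(G)| |V(H)|.
module Submission where

open import Defs
open import Data.Nat using (ℕ; _≤_)
open import Data.Product using (_×_)
open import Data.Rational using (_⊔_) renaming (_≤_ to _≤ℚ_)

open import Data.Bool as Bool using (Bool; true; false; T; _∧_; not)
open import Data.Bool.ListAction using (any)
open import Data.Bool.Properties using (T-∧; T-≡)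
open import Data.Empty using (⊥-elim)
open import Data.Fin as Fin using (Fin; zero; suc; combine; _↑ˡ_; _↑ʳ_; toℕ)
import Data.Fin.Properties as Finₚ
open import Data.Fin.Subset using (Subset; ∣_∣; ⁅_⁆)
open import Data.Fin.Subset.Properties using (x∈⁅y⁆⇒x≡y; x∈⁅y⁆⇔x≡y; ∣⁅x⁆∣≡1)
import Data.Integer as ℤ
import Data.Integer.Properties as ℤ
open import Data.List using (List; []; _∷_; allFin; map; filter)
open import Data.List.Membership.Propositional using (_∈_; lose)
open import Data.List.Membership.Propositional.Properties
  using (∈-allFin; ∈-map⁺; ∈-concat⁺′; ∈-map∘filter⁺; ∈-map∘filter⁻)
open import Data.List.Relation.Unary.Any using (here; there; satisfied)
open import Data.List.Relation.Unary.Any.Properties using (any⁺; any⁻)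
open import Data.Nat as ℕ using (zero; suc; _+_; _*_; _∸_; _<_; z≤n; s≤s)
open import Data.Nat.Properties
open import Data.Nat.Solver using (module +-*-Solver)
open import Data.Product using (_,_; ∃; proj₁; proj₂)
open import Data.Rational as ℚ using (ℚ; mkℚ; 0ℚ; 1ℚ; ½; ↥_; ↧ₙ_)
import Data.Rational.Properties as ℚ
open import Data.Rational.Unnormalised as ℚᵘ using (mkℚᵘ)
import Data.Rational.Unnormalised.Properties as ℚᵘ
open import Data.Unit using (tt)
open import Data.Vec using ([]; _∷_; tabulate; lookup)
open import Data.Vec.Properties using (lookup∘tabulate; lookup⇒[]=; []=⇒lookup)
open import Function using (_∘_)
open import Function.Bundles using (Equivalence; _⇔_; mk⇔)
import Function.Properties.Equivalence as ⇔
open import Relation.Binary.PropositionalEquality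
open import Relation.Nullary using (¬_; Dec; does; yes; no; contradiction)
open import Relation.Nullary.Decidable using (dec-true)

open Equivalence using (to; from)
open import Algebra.Properties.Semiring.Sum +-*-semiring
  using (sum; sum-syntax; sum-cong-≗; sum-replicate-zero; ∑-comm; ∑-distrib-+; *-distribˡ-sum; *-distribʳ-sum)
open +-*-Solver using (solve; _:+_; _:*_; _:=_)

𝟙 : Bool → ℕ
𝟙 true  = 1
𝟙 false = 0

𝟙-∧ : ∀ x y → 𝟙 (x ∧ y) ≡ 𝟙 x * 𝟙 y
𝟙-∧ true  y = sym (+-identityʳ (𝟙 y))
𝟙-∧ false y = refl

𝟙-∧-≤ : ∀ x y → 𝟙 (x ∧ y) ≤ 𝟙 x
𝟙-∧-≤ true  true  = ≤-refl
𝟙-∧-≤ true  false = z≤n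
𝟙-∧-≤ false y     = z≤n

𝟙-≤-∧-not : ∀ x y → 𝟙 x ≤ 𝟙 (x ∧ not y) + 𝟙 y
𝟙-≤-∧-not true  true  = s≤s z≤n
𝟙-≤-∧-not true  false = s≤s z≤n
𝟙-≤-∧-not false y     = z≤n

𝟙-⇔ : ∀ {x y} → T x ⇔ T y → 𝟙 x ≡ 𝟙 y
𝟙-⇔ {true}  {true}  _   = refl
𝟙-⇔ {true}  {false} x⇔y = ⊥-elim (to x⇔y _)
𝟙-⇔ {false} {true}  x⇔y = ⊥-elim (from x⇔y _)
𝟙-⇔ {false} {false} _   = refl

T-does : ∀ {A : Set} (a? : Dec A) → T (does a?) ⇔ A
T-does (yes a) = mk⇔ (λ _ → a) (λ _ → tt)
T-does (no ¬a) = mk⇔ (λ ()) ¬a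

T-not : ∀ {x} → T (not x) ⇔ (¬ T x)
T-not {false} = mk⇔ (λ _ ()) (λ _ → tt)
T-not {true}  = mk⇔ (λ ()) (λ ¬t → ¬t tt)

∑-mono-≤ : ∀ {m} {f g : Fin m → ℕ} → (∀ x → f x ≤ g x) → sum f ≤ sum g
∑-mono-≤ {zero}  f≤g = z≤n
∑-mono-≤ {suc m} f≤g = +-mono-≤ (f≤g zero) (∑-mono-≤ (f≤g ∘ suc))

≤-∑ : ∀ {m} (f : Fin m → ℕ) x → f x ≤ sum f
≤-∑ f zero    = m≤m+n (f zero) _
≤-∑ f (suc x) = ≤-trans (≤-∑ (f ∘ suc) x) (m≤n+m _ (f zero))

∑-1 : ∀ m → ∑[ x < m ] 1 ≡ m
∑-1 zero    = refl
∑-1 (suc m) = cong suc (∑-1 m)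

∑-↑ : ∀ m {d} (f : Fin (m + d) → ℕ) → sum f ≡ ∑[ x < m ] f (x ↑ˡ d) + ∑[ y < d ] f (m ↑ʳ y)
∑-↑ zero    f = refl
∑-↑ (suc m) f = trans (cong (f zero +_) (∑-↑ m (f ∘ suc))) (sym (+-assoc (f zero) _ _))

∑-combine : ∀ m {d} (f : Fin (m * d) → ℕ) → sum f ≡ ∑[ u < m ] ∑[ w < d ] f (combine u w)
∑-combine zero        f = refl
∑-combine (suc m) {d} f =
  trans (∑-↑ d {m * d} f)
        (cong (∑[ w < d ] f (combine {suc m} zero w) +_) (∑-combine m {d} (f ∘ (d ↑ʳ_))))

∑𝟙-pos : ∀ {m} (p : Fin m → Bool) → 1 ≤ ∑[ x < m ] 𝟙 (p x) → ∃ λ x → T (p x)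
∑𝟙-pos {suc m} p 1≤∑ with p zero in eq
... | true  = zero , subst T (sym eq) _
... | false = let x , px = ∑𝟙-pos (p ∘ suc) 1≤∑ in suc x , px

∑𝟙-none : ∀ {m} (p : Fin m → Bool) → (∀ x → ¬ T (p x)) → ∑[ x < m ] 𝟙 (p x) ≡ 0
∑𝟙-none {zero}  p none = refl
∑𝟙-none {suc m} p none with p zero in eq
... | true  = ⊥-elim (none zero (subst T (sym eq) _))
... | false = ∑𝟙-none (p ∘ suc) (none ∘ suc)

∑𝟙-unique : ∀ {m} (p : Fin m → Bool) {x} → T (p x) → (∀ y → T (p y) → y ≡ x) →
            ∑[ y < m ] 𝟙 (p y) ≡ 1
∑𝟙-unique {suc m} p {zero} px only with p zero
... | true  = cong suc (∑𝟙-none (p ∘ suc) (λ y py → Finₚ.0≢1+n (sym (only (suc y) py))))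
... | false = ⊥-elim px
∑𝟙-unique {suc m} p {suc x} px only with p zero in eq
... | true  = ⊥-elim (Finₚ.0≢1+n (only zero (subst T (sym eq) _)))
... | false = ∑𝟙-unique (p ∘ suc) px (λ y py → Finₚ.suc-injective (only (suc y) py))

∑𝟙≥2⇒∃≢ : ∀ {m} (p : Fin m → Bool) → 2 ≤ ∑[ y < m ] 𝟙 (p y) → ∀ x →
           ∃ λ y → y ≢ x × T (p y)
∑𝟙≥2⇒∃≢ {m} p 2≤∑p x =
  let y , qy = ∑𝟙-pos q 1≤∑q
      py , y≉x = to T-∧ qy
  in y , (λ y≡x → to T-not y≉x (from (T-does (y Fin.≟ x)) y≡x)) , py
  where
  q : Fin m → Bool
  q y = p y ∧ not (does (y Fin.≟ x))

  ∑≡x : ∑[ y < m ] 𝟙 (does (y Fin.≟ x)) ≡ 1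
  ∑≡x = ∑𝟙-unique _ (from (T-does (x Fin.≟ x)) refl) (λ y → to (T-does (y Fin.≟ x)))

  ∑p≤∑q+1 : ∑[ y < m ] 𝟙 (p y) ≤ ∑[ y < m ] 𝟙 (q y) + 1
  ∑p≤∑q+1 = begin
    ∑[ y < m ] 𝟙 (p y)                                     ≤⟨ ∑-mono-≤ (λ y → 𝟙-≤-∧-not (p y) _) ⟩
    ∑[ y < m ] (𝟙 (q y) + 𝟙 (does (y Fin.≟ x)))           ≡⟨ ∑-distrib-+ (𝟙 ∘ q) _ ⟩
    ∑[ y < m ] 𝟙 (q y) + ∑[ y < m ] 𝟙 (does (y Fin.≟ x))  ≡⟨ cong (∑[ y < m ] 𝟙 (q y) +_) ∑≡x ⟩
    ∑[ y < m ] 𝟙 (q y) + 1                                 ∎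
    where open ≤-Reasoning

  1≤∑q : 1 ≤ ∑[ y < m ] 𝟙 (q y)
  1≤∑q = +-cancelʳ-≤ 1 1 _ (≤-trans 2≤∑p ∑p≤∑q+1)

∑-partition : ∀ {m} L (c : Fin m → ℕ) → (∀ w → c w < L) → (g : Fin m → ℕ) →
              sum g ≡ ∑[ l < L ] ∑[ w < m ] (𝟙 (does (c w ℕ.≟ toℕ l)) * g w)
∑-partition {m} L c c<L g = sym (begin
  ∑[ l < L ] ∑[ w < m ] (𝟙 (class w l) * g w)    ≡⟨ ∑-comm (λ l w → 𝟙 (class w l) * g w) ⟩
  ∑[ w < m ] ∑[ l < L ] (𝟙 (class w l) * g w)    ≡⟨ sum-cong-≗ (λ w → sym (*-distribʳ-sum (g w) (𝟙 ∘ class w))) ⟩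
  ∑[ w < m ] ((∑[ l < L ] 𝟙 (class w l)) * g w) ≡⟨ sum-cong-≗ (λ w → cong (_* g w) (one-class w)) ⟩
  ∑[ w < m ] (1 * g w)                           ≡⟨ sum-cong-≗ (λ w → *-identityˡ (g w)) ⟩
  sum g                                          ∎)
  where
  open ≡-Reasoning
  class : Fin m → Fin L → Bool
  class w l = does (c w ℕ.≟ toℕ l)

  one-class : ∀ w → ∑[ l < L ] 𝟙 (class w l) ≡ 1
  one-class w = ∑𝟙-unique (class w) (from (T-does (c w ℕ.≟ _)) (sym (Finₚ.toℕ-fromℕ< (c<L w))))
    (λ l cw≡l → Finₚ.toℕ-injective
       (trans (sym (to (T-does (c w ℕ.≟ toℕ l)) cw≡l)) (sym (Finₚ.toℕ-fromℕ< (c<L w)))))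

∣_∣≡∑ : ∀ {m} (S : Subset m) → ∣ S ∣ ≡ ∑[ x < m ] 𝟙 (lookup S x)
∣ []        ∣≡∑ = refl
∣ true  ∷ S ∣≡∑ = cong suc ∣ S ∣≡∑
∣ false ∷ S ∣≡∑ = ∣ S ∣≡∑

T-⁅⁆ : ∀ {m} (v w : Fin m) → T (lookup ⁅ v ⁆ w) ⇔ (w ≡ v)
T-⁅⁆ v w = mk⇔ (x∈⁅y⁆⇒x≡y v ∘ lookup⇒[]= w ⁅ v ⁆ ∘ to T-≡)
               (from T-≡ ∘ []=⇒lookup ∘ from x∈⁅y⁆⇔x≡y)

T-any-allFin : ∀ {m} (p : Fin m → Bool) → T (any p (allFin m)) ⇔ (∃ λ x → T (p x))
T-any-allFin {m} p = mk⇔ (satisfied ∘ any⁻ p (allFin m)) (λ (x , px) → any⁺ p (lose (∈-allFin x) px))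

∈-allSubsets : ∀ {m} (S : Subset m) → S ∈ allSubsets m
∈-allSubsets []          = here refl
∈-allSubsets (false ∷ S) = ∈-concat⁺′ (here refl) (∈-map⁺ _ (∈-allSubsets S))
∈-allSubsets (true  ∷ S) = ∈-concat⁺′ (there (here refl)) (∈-map⁺ _ (∈-allSubsets S))

Independent : (G : Graph) → Subset (n G) → Set
Independent G S = ∀ u v → T (lookup S u) → T (lookup S v) → ¬ T (adj G u v)

T-isIndependent : ∀ G S → T (isIndependent G S) ⇔ Independent G S
T-isIndependent G S = mk⇔
  (λ indep u v Su Sv uv → to T-not indep
     (from (T-any-allFin _) (u , from (T-any-allFin _) (v , from T-∧ (Su , from T-∧ (Sv , uv))))))
  (λ S-independent → from T-not λ edge →
     let u , edgeᵤ   = to (T-any-allFin _) edge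
         v , edgeᵤᵥ  = to (T-any-allFin _) edgeᵤ
         Su , Sv∧uv = to T-∧ edgeᵤᵥ
         Sv , uv    = to T-∧ Sv∧uv
     in S-independent u v Su Sv uv)

T-nbhd : ∀ G S v → T (lookup (nbhd G S) v) ⇔ (∃ λ u → T (lookup S u) × T (adj G u v))
T-nbhd G S v = mk⇔
  (λ t → let u , st = to (T-any-allFin _) (subst T (lookup∘tabulate _ v) t) in u , to T-∧ st)
  (λ (u , st) → subst T (sym (lookup∘tabulate _ v)) (from (T-any-allFin _) (u , from T-∧ st)))

⁅⁆-independent : ∀ G v → Independent G ⁅ v ⁆
⁅⁆-independent G v u u' u∈ u'∈ uu'
  with refl ← to (T-⁅⁆ v u) u∈ | refl ← to (T-⁅⁆ v u') u'∈ = subst T (adj-irrefl G v) uu'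

T-nbhd-⁅⁆ : ∀ G v w → T (lookup (nbhd G ⁅ v ⁆) w) ⇔ T (adj G v w)
T-nbhd-⁅⁆ G v w = mk⇔
  (λ t → let u , u∈ , uw = to (T-nbhd G ⁅ v ⁆ w) t in subst (λ u → T (adj G u w)) (to (T-⁅⁆ v u) u∈) uw)
  (λ vw → from (T-nbhd G ⁅ v ⁆ w) (v , from (T-⁅⁆ v v) refl , vw))

num : ℚ → ℕ
num A = ℤ.∣ ↥ A ∣

-- frac normalises the fraction, so compare through the unnormalised x / suc y.
frac≤⇔ : ∀ {A} x y → 0ℚ ≤ℚ A → frac x (suc y) ≤ℚ A ⇔ (x * ↧ₙ A ≤ num A * suc y)
frac≤⇔ {mkℚ ℤ.-[1+ _ ] _ _} x y (ℚ.*≤* ())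
frac≤⇔ {A@(mkℚ (ℤ.+ p) d _)} x y _ = mk⇔
  (λ le → ℤ.drop‿+≤+ (unnormalised (ℚᵘ.≤-respˡ-≃ frac≃ (ℚ.toℚᵘ-mono-≤ le))))
  (λ le → ℚ.toℚᵘ-cancel-≤ (ℚᵘ.≤-respˡ-≃ (ℚᵘ.≃-sym frac≃) (ℚᵘ.*≤* (normalised (ℤ.+≤+ le)))))
  where
  frac≃ : ℚ.toℚᵘ (frac x (suc y)) ℚᵘ.≃ mkℚᵘ (ℤ.+ x) y
  frac≃ = ℚ.toℚᵘ-fromℚᵘ (mkℚᵘ (ℤ.+ x) y)
  unnormalised : mkℚᵘ (ℤ.+ x) y ℚᵘ.≤ ℚ.toℚᵘ A → ℤ.+ (x * suc d) ℤ.≤ ℤ.+ (p * suc y)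
  unnormalised (ℚᵘ.*≤* le) = subst₂ ℤ._≤_ (sym (ℤ.pos-* x (suc d))) (sym (ℤ.pos-* p (suc y))) le
  normalised : ℤ.+ (x * suc d) ℤ.≤ ℤ.+ (p * suc y) → ℤ.+ x ℤ.* ℤ.+ suc d ℤ.≤ ℤ.+ p ℤ.* ℤ.+ suc y
  normalised = subst₂ ℤ._≤_ (ℤ.pos-* x (suc d)) (ℤ.pos-* p (suc y))

frac≤-intro : ∀ {A} x N → 0ℚ ≤ℚ A → x * ↧ₙ A ≤ num A * N → frac x N ≤ℚ A
frac≤-intro x zero    0≤A _ = 0≤A
frac≤-intro x (suc N) 0≤A   = from (frac≤⇔ x N 0≤A)

frac≤1 : ∀ x N → x ≤ N → frac x N ≤ℚ 1ℚ
frac≤1 x N x≤N = frac≤-intro x N (ℚ.nonNegative⁻¹ 1ℚ)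
  (subst₂ _≤_ (sym (*-identityʳ x)) (sym (*-identityˡ N)) x≤N)

≤-maxℚ : ∀ {x} xs → x ∈ xs → x ≤ℚ maxℚ xs
≤-maxℚ (y ∷ ys) (here refl) = ℚ.p≤p⊔q y (maxℚ ys)
≤-maxℚ (y ∷ ys) (there x∈) = ℚ.p≤q⇒p≤r⊔q y (≤-maxℚ ys x∈)

0≤maxℚ : ∀ xs → 0ℚ ≤ℚ maxℚ xs
0≤maxℚ []       = ℚ.≤-refl
0≤maxℚ (y ∷ ys) = ℚ.p≤q⇒p≤r⊔q y (0≤maxℚ ys)

maxℚ-lub : ∀ {B} xs → 0ℚ ≤ℚ B → (∀ {x} → x ∈ xs → x ≤ℚ B) → maxℚ xs ≤ℚ B
maxℚ-lub []       0≤B ≤B = 0≤B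
maxℚ-lub (y ∷ ys) 0≤B ≤B = ℚ.⊔-lub (≤B (here refl)) (maxℚ-lub ys 0≤B (≤B ∘ there))

maxℕ*-lub : ∀ {Q B} xs → (∀ {x} → x ∈ xs → x * Q ≤ B) → maxℕ xs * Q ≤ B
maxℕ*-lub         []       ≤B = z≤n
maxℕ*-lub {Q} {B} (y ∷ ys) ≤B = begin
  (y ℕ.⊔ maxℕ ys) * Q    ≡⟨ *-distribʳ-⊔ Q y (maxℕ ys) ⟩
  y * Q ℕ.⊔ maxℕ ys * Q  ≤⟨ ⊔-lub (≤B (here refl)) (maxℕ*-lub ys (≤B ∘ there)) ⟩
  B                      ∎
  where open ≤-Reasoning

ratio : (G : Graph) → Subset (n G) → ℚ
ratio G S = frac ∣ S ∣ (∣ S ∣ + ∣ nbhd G S ∣)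

ratios : Graph → List ℚ
ratios G = map (ratio G) (filter (λ S → (isIndependent G S ∧ isNonempty S) Bool.≟ true) (allSubsets (n G)))

ratio≤a : ∀ G S → Independent G S → (∃ λ u → T (lookup S u)) → ratio G S ≤ℚ a G
ratio≤a G S S-independent nonempty = ≤-maxℚ (ratios G)
  (∈-map∘filter⁺ (ratio G) (λ S → (isIndependent G S ∧ isNonempty S) Bool.≟ true)
    (S , ∈-allSubsets S , refl ,
     to T-≡ (from T-∧ (from (T-isIndependent G S) S-independent , from (T-any-allFin _) nonempty))))

0≤a : ∀ G → 0ℚ ≤ℚ a G
0≤a G = 0≤maxℚ (ratios G)

a≤1 : ∀ G → a G ≤ℚ 1ℚ
a≤1 G = maxℚ-lub (ratios G) (ℚ.nonNegative⁻¹ 1ℚ) λ r∈ →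
  let S , _ , r≡ , _ = ∈-map∘filter⁻ (ratio G) (λ S → (isIndependent G S ∧ isNonempty S) Bool.≟ true)
                                     {xs = allSubsets (n G)} r∈
  in subst (_≤ℚ 1ℚ) (sym r≡) (frac≤1 _ _ (m≤m+n ∣ S ∣ ∣ nbhd G S ∣))

a≤a* : ∀ G → a G ≤ℚ a* G
a≤a* G with a G ℚ.≤? ½
... | yes _ = ℚ.≤-refl
... | no  _ = a≤1 G

α-bound : ∀ G {Q B} → (∀ S → Independent G S → ∣ S ∣ * Q ≤ B) → α G * Q ≤ B
α-bound G bound = maxℕ*-lub (map ∣_∣ (filter (λ S → isIndependent G S Bool.≟ true) (allSubsets (n G)))) λ s∈ →
  let S , _ , s≡ , indep = ∈-map∘filter⁻ ∣_∣ (λ S → isIndependent G S Bool.≟ true) {xs = allSubsets (n G)} s∈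
  in subst (λ s → s * _ ≤ _) (sym s≡) (bound S (to (T-isIndependent G S) (from T-≡ indep)))

-- Per-vertex accounting for the heavy set S: η says u ∈ S, ν says u ∈ N(S).
vertex-budget : ∀ {x k} η ν → x ≤ k → (T η ⇔ (2 ≤ x)) → (T ν → x ≡ 0) →
                (x + 𝟙 η + 𝟙 ν ≤ 1 + k * 𝟙 η) × (𝟙 η + 𝟙 ν ≤ 1)
vertex-budget true true _ heavy empty = contradiction (subst (2 ≤_) (empty _) (to heavy _)) λ ()
vertex-budget {x} {k} true false x≤k _ _ rewrite *-identityʳ k | +-identityʳ (x + 1) | +-comm x 1 =
  s≤s x≤k , s≤s z≤n
vertex-budget {x} {k} false true _ _ empty rewrite empty _ | *-zeroʳ k = s≤s z≤n , s≤s z≤n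
vertex-budget {x} {k} false false _ heavy _ rewrite *-zeroʳ k | +-identityʳ x | +-identityʳ x =
  ≤-pred (≰⇒> (from heavy)) , z≤n

weight-arith : ∀ {X s t N k P Q} → X + s + t ≤ N + k * s → s + t ≤ N →
               s * Q ≤ P * (s + t) → Q ≤ P * k → X * Q ≤ P * N * k
weight-arith {X} {s} {t} {N} {k} {P} {Q} budget s+t≤N heavy single = begin
  X * Q                            ≤⟨ *-monoˡ-≤ Q X≤w+ks ⟩
  (w + k * s) * Q                  ≡⟨ solve 4 (λ w k s Q → (w :+ k :* s) :* Q := w :* Q :+ k :* (s :* Q)) refl w k s Q ⟩
  w * Q + k * (s * Q)              ≤⟨ +-mono-≤ (*-monoʳ-≤ w single) (*-monoʳ-≤ k heavy) ⟩
  w * (P * k) + k * (P * (s + t))  ≡⟨ solve 5 (λ w k s t P → w :* (P :* k) :+ k :* (P :* (s :+ t)) := P :* (w :+ (s :+ t)) :* k) refl w k s t P ⟩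
  P * (w + (s + t)) * k            ≡⟨ cong (λ m → P * m * k) (m∸n+n≡m s+t≤N) ⟩
  P * N * k                        ∎
  where
  open ≤-Reasoning
  w : ℕ
  w = N ∸ (s + t)
  X≤w+ks : X ≤ w + k * s
  X≤w+ks = +-cancelʳ-≤ (s + t) X (w + k * s) (begin
    X + (s + t)          ≡⟨ +-assoc X s t ⟨
    X + s + t            ≤⟨ budget ⟩
    N + k * s            ≡⟨ cong (_+ k * s) (m∸n+n≡m s+t≤N) ⟨
    w + (s + t) + k * s  ≡⟨ solve 4 (λ w s t ks → w :+ (s :+ t) :+ ks := w :+ ks :+ (s :+ t)) refl w s t (k * s) ⟩
    w + k * s + (s + t)  ∎)

-- a(G) ≤ P / Q with denominators cleared; the empty set satisfies it
-- trivially, so it ranges over all independent sets.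
a[_]≤_/_ : Graph → ℕ → ℕ → Set
a[ G ]≤ P / Q = ∀ S → Independent G S → ∣ S ∣ * Q ≤ P * (∣ S ∣ + ∣ nbhd G S ∣)

a≤⇒a[]≤ : ∀ {G A} → 0ℚ ≤ℚ A → a G ≤ℚ A → a[ G ]≤ num A / ↧ₙ A
a≤⇒a[]≤ {G} {A} 0≤A a≤A S S-independent with ∣ S ∣ in ∣S∣≡
... | zero  = z≤n
... | suc s = to (frac≤⇔ (suc s) (s + ∣ nbhd G S ∣) 0≤A)
                 (subst (λ m → frac m (m + ∣ nbhd G S ∣) ≤ℚ A) ∣S∣≡
                        (ℚ.≤-trans (ratio≤a G S S-independent nonempty) a≤A))
  where
  nonempty : ∃ λ u → T (lookup S u)
  nonempty = ∑𝟙-pos (lookup S) (subst (1 ≤_) (trans (sym ∣S∣≡) ∣ S ∣≡∑) (s≤s z≤n))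

heavy-set : ∀ {G} k (f : V G → ℕ) → (∀ u → f u ≤ k) →
            (∀ u v → 2 ≤ f u → 1 ≤ f v → ¬ T (adj G u v)) →
            ∃ λ S → Independent G S
                  × (sum f + ∣ S ∣ + ∣ nbhd G S ∣ ≤ n G + k * ∣ S ∣)
                  × (∣ S ∣ + ∣ nbhd G S ∣ ≤ n G)
heavy-set {G} k f f≤k isolated = S , S-independent , budget-total , disjoint-total
  where
  S : Subset (n G)
  S = tabulate (λ u → does (2 ℕ.≤? f u))

  heavy : ∀ u → T (lookup S u) ⇔ (2 ≤ f u)
  heavy u = mk⇔ (to (T-does (2 ℕ.≤? f u)) ∘ subst T (lookup∘tabulate _ u))
                (subst T (sym (lookup∘tabulate _ u)) ∘ from (T-does (2 ℕ.≤? f u)))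

  S-independent : Independent G S
  S-independent u v Su Sv = isolated u v (to (heavy u) Su) (≤-trans (s≤s z≤n) (to (heavy v) Sv))

  nbhd-empty : ∀ u → T (lookup (nbhd G S) u) → f u ≡ 0
  nbhd-empty u t = let v , Sv , vu = to (T-nbhd G S u) t in
    n<1⇒n≡0 (≰⇒> λ 1≤fu → isolated v u (to (heavy v) Sv) 1≤fu vu)

  σ ν : V G → ℕ
  σ u = 𝟙 (lookup S u)
  ν u = 𝟙 (lookup (nbhd G S) u)

  budget : ∀ u → (f u + σ u + ν u ≤ 1 + k * σ u) × (σ u + ν u ≤ 1)
  budget u = vertex-budget (lookup S u) (lookup (nbhd G S) u) (f≤k u) (heavy u) (nbhd-empty u)

  ∣S∣+∣N∣≡ : ∣ S ∣ + ∣ nbhd G S ∣ ≡ ∑[ u < n G ] (σ u + ν u)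
  ∣S∣+∣N∣≡ = trans (cong₂ _+_ ∣ S ∣≡∑ ∣ nbhd G S ∣≡∑) (sym (∑-distrib-+ σ ν))

  budget-total : sum f + ∣ S ∣ + ∣ nbhd G S ∣ ≤ n G + k * ∣ S ∣
  budget-total = begin
    sum f + ∣ S ∣ + ∣ nbhd G S ∣              ≡⟨ +-assoc (sum f) _ _ ⟩
    sum f + (∣ S ∣ + ∣ nbhd G S ∣)            ≡⟨ cong (sum f +_) ∣S∣+∣N∣≡ ⟩
    sum f + ∑[ u < n G ] (σ u + ν u)          ≡⟨ ∑-distrib-+ f (λ u → σ u + ν u) ⟨
    ∑[ u < n G ] (f u + (σ u + ν u))          ≡⟨ sum-cong-≗ (λ u → +-assoc (f u) (σ u) (ν u)) ⟨
    ∑[ u < n G ] (f u + σ u + ν u)            ≤⟨ ∑-mono-≤ (proj₁ ∘ budget) ⟩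
    ∑[ u < n G ] (1 + k * σ u)                ≡⟨ ∑-distrib-+ (λ _ → 1) (λ u → k * σ u) ⟩
    ∑[ u < n G ] 1 + ∑[ u < n G ] (k * σ u)  ≡⟨ cong₂ _+_ (∑-1 (n G)) (sym (*-distribˡ-sum k σ)) ⟩
    n G + k * sum σ                           ≡⟨ cong (λ s → n G + k * s) ∣ S ∣≡∑ ⟨
    n G + k * ∣ S ∣                           ∎
    where open ≤-Reasoning

  disjoint-total : ∣ S ∣ + ∣ nbhd G S ∣ ≤ n G
  disjoint-total = begin
    ∣ S ∣ + ∣ nbhd G S ∣         ≡⟨ ∣S∣+∣N∣≡ ⟩
    ∑[ u < n G ] (σ u + ν u)    ≤⟨ ∑-mono-≤ (proj₂ ∘ budget) ⟩
    ∑[ u < n G ] 1              ≡⟨ ∑-1 (n G) ⟩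
    n G                         ∎
    where open ≤-Reasoning

weight-bound : ∀ {G P Q} → a[ G ]≤ P / Q → ∀ k (f : V G → ℕ) → (∀ u → f u ≤ k) →
               (∀ u v → 2 ≤ f u → 1 ≤ f v → ¬ T (adj G u v)) → (1 ≤ k → Q ≤ P * k) →
               sum f * Q ≤ P * n G * k
weight-bound {G} aG zero f f≤0 _ _
  rewrite n≤0⇒n≡0 (≤-trans (∑-mono-≤ f≤0) (≤-reflexive (sum-replicate-zero (n G)))) = z≤n
weight-bound {G} {P} {Q} aG k@(suc _) f f≤k isolated single =
  let S , S-independent , budget , disjoint = heavy-set {G} k f f≤k isolated
  in weight-arith {sum f} {∣ S ∣} {∣ nbhd G S ∣} {n G} {k} {P} {Q}
                  budget disjoint (aG S S-independent) (single (s≤s z≤n))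

IsClique : (H : Graph) → (V H → Bool) → Set
IsClique H C = ∀ w w' → T (C w) → T (C w') → w ≢ w' → T (adj H w w')

adj-⊗ : ∀ G H u w u' w' →
        adj (G ⊗ H) (combine u w) (combine u' w') ≡ (adj G u u' ∧ adj H w w')
adj-⊗ G H u w u' w' = cong₂ (λ x x' → adj G (proj₁ x) (proj₁ x') ∧ adj H (proj₂ x) (proj₂ x'))
  (Finₚ.remQuot-combine {n G} {n H} u w) (Finₚ.remQuot-combine {n G} {n H} u' w')

module _ (G H : Graph) (I : Subset (n (G ⊗ H))) where

  fibre : V G → V H → Bool
  fibre u w = lookup I (combine u w)

  fibreSize : (V H → Bool) → V G → ℕ
  fibreSize C u = ∑[ w < n H ] 𝟙 (C w ∧ fibre u w)

  fibreSize≤ : ∀ C u → fibreSize C u ≤ ∑[ w < n H ] 𝟙 (C w)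
  fibreSize≤ C u = ∑-mono-≤ (λ w → 𝟙-∧-≤ (C w) (fibre u w))

  fibreSize-isolated : Independent (G ⊗ H) I → ∀ {C} → IsClique H C →
                       ∀ u u' → 2 ≤ fibreSize C u → 1 ≤ fibreSize C u' → ¬ T (adj G u u')
  fibreSize-isolated I-independent {C} clique u u' 2≤ 1≤ uu' =
    let w' , C∧Iw' = ∑𝟙-pos (λ w → C w ∧ fibre u' w) 1≤
        w , w≢w' , C∧Iw = ∑𝟙≥2⇒∃≢ (λ w → C w ∧ fibre u w) 2≤ w'
        Cw , Iw = to T-∧ C∧Iw
        Cw' , Iw' = to T-∧ C∧Iw'
    in I-independent (combine u w) (combine u' w') Iw Iw'
         (subst T (sym (adj-⊗ G H u w u' w')) (from T-∧ (uu' , clique w w' Cw Cw' w≢w')))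

module _ {H : Graph} (c : V H → ℕ) (hc : ∀ u v → (adj H u v ≡ true) ⇔ ((¬ (u ≡ v)) × (c u ≡ c v))) where

  component : ℕ → V H → Bool
  component l w = does (c w ℕ.≟ l)

  componentSize : ℕ → ℕ
  componentSize l = ∑[ w < n H ] 𝟙 (component l w)

  component-clique : ∀ l → IsClique H (component l)
  component-clique l w w' Cw Cw' w≢w' =
    from T-≡ (from (hc w w') (w≢w' , trans (to (T-does (c w ℕ.≟ l)) Cw) (sym (to (T-does (c w' ℕ.≟ l)) Cw'))))

  closed-nbhd-size : ∀ v → 1 + ∣ nbhd H ⁅ v ⁆ ∣ ≡ componentSize (c v)
  closed-nbhd-size v = begin
    1 + ∣ nbhd H ⁅ v ⁆ ∣                                      ≡⟨ cong₂ _+_ (sym ∑self) ∣ nbhd H ⁅ v ⁆ ∣≡∑ ⟩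
    ∑[ w < n H ] self w + ∑[ w < n H ] 𝟙 (lookup (nbhd H ⁅ v ⁆) w) ≡⟨ ∑-distrib-+ self _ ⟨
    ∑[ w < n H ] (self w + 𝟙 (lookup (nbhd H ⁅ v ⁆) w))       ≡⟨ sum-cong-≗ pointwise ⟩
    componentSize (c v)                                      ∎
    where
    open ≡-Reasoning
    self : V H → ℕ
    self w = 𝟙 (does (w Fin.≟ v))

    ∑self : ∑[ w < n H ] self w ≡ 1
    ∑self = ∑𝟙-unique _ (from (T-does (v Fin.≟ v)) refl) (λ w → to (T-does (w Fin.≟ v)))

    pointwise : ∀ w → self w + 𝟙 (lookup (nbhd H ⁅ v ⁆) w) ≡ 𝟙 (component (c v) w)
    pointwise w with w Fin.≟ v
    ... | yes refl = trans (cong suc (trans (𝟙-⇔ (T-nbhd-⁅⁆ H v v)) (cong 𝟙 (adj-irrefl H v))))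
                           (cong 𝟙 (sym (dec-true (c v ℕ.≟ c v) refl)))
    ... | no  w≢v  = 𝟙-⇔ (⇔.trans (T-nbhd-⁅⁆ H v w) (mk⇔
                       (λ vw → from (T-does (c w ℕ.≟ c v)) (sym (proj₂ (to (hc v w) (to T-≡ vw)))))
                       (λ cw≡cv → from T-≡ (from (hc v w) (w≢v ∘ sym , sym (to (T-does (c w ℕ.≟ c v)) cw≡cv))))))

  vertex-bound : ∀ {P Q} → a[ H ]≤ P / Q → ∀ v → Q ≤ P * componentSize (c v)
  vertex-bound {P} {Q} aH v = begin
    Q                                   ≡⟨ *-identityˡ Q ⟨
    1 * Q                               ≡⟨ cong (_* Q) (∣⁅x⁆∣≡1 v) ⟨
    ∣ ⁅ v ⁆ ∣ * Q                        ≤⟨ aH ⁅ v ⁆ (⁅⁆-independent H v) ⟩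
    P * (∣ ⁅ v ⁆ ∣ + ∣ nbhd H ⁅ v ⁆ ∣)    ≡⟨ cong (λ s → P * (s + ∣ nbhd H ⁅ v ⁆ ∣)) (∣⁅x⁆∣≡1 v) ⟩
    P * (1 + ∣ nbhd H ⁅ v ⁆ ∣)           ≡⟨ cong (P *_) (closed-nbhd-size v) ⟩
    P * componentSize (c v)             ∎
    where open ≤-Reasoning

  independent-⊗-bound : ∀ {G P Q} → a[ G ]≤ P / Q → a[ H ]≤ P / Q →
                        ∀ I → Independent (G ⊗ H) I → ∣ I ∣ * Q ≤ P * n G * n H
  independent-⊗-bound {G} {P} {Q} aG aH I I-independent = begin
    ∣ I ∣ * Q                           ≡⟨ cong (_* Q) count-I ⟩
    (∑[ l < L ] sum (fibres l)) * Q     ≡⟨ *-distribʳ-sum Q (sum ∘ fibres) ⟩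
    ∑[ l < L ] (sum (fibres l) * Q)     ≤⟨ ∑-mono-≤ component-bound ⟩
    ∑[ l < L ] (P * n G * size l)       ≡⟨ *-distribˡ-sum (P * n G) size ⟨
    P * n G * ∑[ l < L ] size l         ≡⟨ cong (P * n G *_) count-H ⟨
    P * n G * n H                       ∎
    where
    open ≤-Reasoning
    L : ℕ
    L = suc (sum c)

    c<L : ∀ w → c w < L
    c<L w = s≤s (≤-∑ c w)

    C : Fin L → V H → Bool
    C l = component (toℕ l)

    fibres : Fin L → V G → ℕ
    fibres l = fibreSize G H I (C l)

    size : Fin L → ℕ
    size l = componentSize (toℕ l)

    component-bound : ∀ l → sum (fibres l) * Q ≤ P * n G * size l
    component-bound l = weight-bound {G} {P} {Q} aG (size l) (fibres l) (fibreSize≤ G H I (C l))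
      (fibreSize-isolated G H I I-independent (component-clique (toℕ l))) occupied
      where
      occupied : 1 ≤ size l → Q ≤ P * size l
      occupied 1≤ = let v , Cv = ∑𝟙-pos (C l) 1≤ in
        subst (λ k → Q ≤ P * componentSize k) (to (T-does (c v ℕ.≟ toℕ l)) Cv) (vertex-bound {P} {Q} aH v)

    count-I : ∣ I ∣ ≡ ∑[ l < L ] sum (fibres l)
    count-I = begin-equality
      ∣ I ∣                                                      ≡⟨ ∣ I ∣≡∑ ⟩
      ∑[ x < n G * n H ] 𝟙 (lookup I x)                          ≡⟨ ∑-combine (n G) {n H} _ ⟩
      ∑[ u < n G ] ∑[ w < n H ] 𝟙I u w                           ≡⟨ sum-cong-≗ (λ u → ∑-partition L c c<L (𝟙I u)) ⟩
      ∑[ u < n G ] ∑[ l < L ] ∑[ w < n H ] (𝟙 (C l w) * 𝟙I u w)  ≡⟨ ∑-comm (λ u l → ∑[ w < n H ] (𝟙 (C l w) * 𝟙I u w)) ⟩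
      ∑[ l < L ] ∑[ u < n G ] ∑[ w < n H ] (𝟙 (C l w) * 𝟙I u w)  ≡⟨ sum-cong-≗ (λ l → sum-cong-≗ (λ u → sum-cong-≗ (λ w →
                                                                    𝟙-∧ (C l w) (fibre G H I u w)))) ⟨
      ∑[ l < L ] sum (fibres l)                                  ∎
      where
      𝟙I : V G → V H → ℕ
      𝟙I u w = 𝟙 (fibre G H I u w)

    count-H : n H ≡ ∑[ l < L ] size l
    count-H = begin-equality
      n H                                      ≡⟨ ∑-1 (n H) ⟨
      ∑[ w < n H ] 1                           ≡⟨ ∑-partition L c c<L _ ⟩
      ∑[ l < L ] ∑[ w < n H ] (𝟙 (C l w) * 1)  ≡⟨ sum-cong-≗ (λ l → sum-cong-≗ (λ w → *-identityʳ (𝟙 (C l w)))) ⟩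
      ∑[ l < L ] size l                        ∎

i-⊗-bound : ∀ G H → IsDisjointUnionOfCompletes H → i (G ⊗ H) ≤ℚ (a G ⊔ a H)
i-⊗-bound G H (c , hc) = frac≤-intro (α (G ⊗ H)) (n G * n H) 0≤A
  (α-bound (G ⊗ H) λ I I-independent →
    subst (∣ I ∣ * ↧ₙ A ≤_) (*-assoc (num A) (n G) (n H))
          (independent-⊗-bound {H} c hc {G} {num A} {↧ₙ A} aG aH I I-independent))
  where
  A : ℚ
  A = a G ⊔ a H

  0≤A : 0ℚ ≤ℚ A
  0≤A = ℚ.≤-trans (0≤a G) (ℚ.p≤p⊔q (a G) (a H))

  aG : a[ G ]≤ num A / ↧ₙ A
  aG = a≤⇒a[]≤ {G} 0≤A (ℚ.p≤p⊔q (a G) (a H))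

  aH : a[ H ]≤ num A / ↧ₙ A
  aH = a≤⇒a[]≤ {H} 0≤A (ℚ.p≤q⊔p (a G) (a H))

K-isDisjointUnionOfCompletes : ∀ k → IsDisjointUnionOfCompletes (K k)
K-isDisjointUnionOfCompletes k = (λ _ → 0) , λ u v → mk⇔
  (λ uv → (λ u≡v → to T-not (from T-≡ uv) (from (T-does (u Fin.≟ v)) u≡v)) , refl)
  (λ (u≢v , _) → to T-≡ (from T-not (u≢v ∘ to (T-does (u Fin.≟ v)))))

proposition3p8 :
    ((G : Graph) (k : ℕ) → 1 ≤ k →
        (i (G ⊗ K k) ≤ℚ (a G ⊔ a (K k)))
      × (i (G ⊗ K k) ≤ℚ (a* G ⊔ a* (K k))))
    × ((G H : Graph) → IsDisjointUnionOfCompletes H →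
        i (G ⊗ H) ≤ℚ (a G ⊔ a H))
proposition3p8 = (λ G k _ → let i≤a = i-⊗-bound G (K k) (K-isDisjointUnionOfCompletes k) in
                    i≤a , ℚ.≤-trans i≤a (ℚ.⊔-mono-≤ (a≤a* G) (a≤a* (K k))))
               , i-⊗-bound
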